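{- In any execution of the DRL transition system: (1) once $\mathrm{CreatedUsing}(y: A\to C, z: B\to C)$ is added to $A$'s knowledge set, it is not removed until after $A$ has sent an info message containing $z$ to $C$; (2) once $\mathrm{Created}(z: B\to C)$ is added to $C$'s knowledge set, it is not removed until after $C$ has received the (unique) release message along $z$; (3) once $\mathrm{Released}(z: B\to C)$ is added to $C$'s knowledge set, it is not removed until after $C$ has received the (unique) info message containing $z$.
   Context: DRL transition system. Refobs are triples $x: A\to B$ (owner $A$, target $B$, unique token $x$). Facts: $\mathrm{Created}(x)$, $\mathrm{Released}(x)$, $\mathrm{CreatedUsing}(x,y)$, $\mathrm{Activated}(x)$, $\mathrm{Unreleased}(x)$, $\mathrm{SentCount}(x,n)$, $\mathrm{RecvCount}(x,n)$; $\Phi\vdash\phi$ is derivability from a knowledge set $\Phi$ in first-order logic plus: absent any $\mathrm{SentCount}(x,n)$, $\Phi\vdash\mathrm{SentCount}(x,0)$; likewise $\mathrm{RecvCount}$; $\mathrm{Created}(x)\wedge\neg\mathrm{Released}(x)$ yields $\mathrm{Unreleased}(x)$; $\mathrm{CreatedUsing}(x,y)$ yields $\mathrm{Created}(y)$. Configurations $(\alpha,\mu,\rho,\chi)$ (internal actors' knowledge sets, busy or idle; undelivered message multisets; receptionists; external actors). Initial configuration: one busy actor $A$ with $\{\mathrm{Activated}(x:A\to E),\mathrm{Created}(y:A\to A),\mathrm{Activated}(y:A\to A)\}$, no messages, $\rho=\emptyset$, $\chi=\{E\}$. Rules: Spawn (busy $A$ spawns fresh $B$ with fresh $x,y$: $A$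 adds $\mathrm{Activated}(x:A\to B)$, $B$ starts busy with $\{\mathrm{Created}(x),\mathrm{Created}(y:B\to B),\mathrm{Activated}(y)\}$); Send (busy $A$ with $\Phi\vdash\mathrm{Activated}(x:A\to B)$ and $\Phi\vdash\mathrm{Activated}(y_i:A\to C_i)$, fresh $z_i$: increments send count of $x$, adds $\mathrm{CreatedUsing}(y_i,z_i)$, sends $\mathrm{app}(x,\{z_i:B\to C_i\})$ to $B$); Receive (idle $B$ consumes $\mathrm{app}(x,R)$, becomes busy, increments receive count of $x$, adds $\mathrm{Activated}(z)$, $z\in R$); Idle; SendInfo (busy $A$ removes $\mathrm{CreatedUsing}(y:A\to C,z:B\to C)$, increments send count of $y$, sends $\mathrm{info}(y,z,B)$, which contains $z$, to $C$ along $y$); Info (idle $C$ consumes it, increments receive count of $y$, adds $\mathrm{Created}(z)$); SendRelease (busy $A$ with $\mathrm{Activated}(x:A\to B),\mathrm{SentCount}(x,n)$ and no $\mathrm{CreatedUsing}(x,\cdot)$ removes both facts and sends $\mathrm{release}(x,n)$ to $B$ along $x$); Release (idle $B$ with $\Phi\vdash\mathrm{RecvCount}(x,n)$ consumes $\mathrm{release}(x,n)$ and adds $\mathrm{Released}(x)$); Compaction (idle $C$ removes $\mathrm{Created}(x:B\to C)$, $\mathrm{Released}(x)$ and $\mathrm{RecvCount}(x,\cdot)$, only when both $\mathrm{Created}(x)$ and $\mathrm{Released}(x)$ are present); Snapshot (no change); In, Out, ReleaseOut, InfoOut (interaction with external actors). -}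

module Defs where

open import Data.Nat using (ℕ; zero; suc; _≡ᵇ_; _≤_; _<_)
open import Data.Bool using (Bool; true; false; _∧_; not; if_then_else_)
open import Data.Maybe using (Maybe; just; nothing; is-just)
open import Data.List using (List; []; _∷_; _++_; map; filterᵇ)
open import Data.List.Membership.Propositional using (_∈_; _∉_)
open import Data.List.Relation.Unary.All using (All)
open import Data.List.Relation.Unary.Any using (Any)
open import Data.List.Relation.Unary.Unique.Propositional using (Unique)
open import Data.Product using (Σ; ∃; ∃₂; _×_; _,_; proj₁; proj₂)
open import Data.Sum using (_⊎_)
open import Relation.Nullary using (¬_)
open import Relation.Binary.PropositionalEquality using (_≡_; _≢_)

Actor : Set
Actor = ℕ

Token : Set
Token = ℕ

-- A refob  x : A → B  is the triple (token x, owner A, target B).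
record Refob : Set where
  constructor ref
  field
    token  : Token
    owner  : Actor
    target : Actor
open Refob public

_==R_ : Refob → Refob → Bool
ref a b c ==R ref a' b' c' = (a ≡ᵇ a') ∧ ((b ≡ᵇ b') ∧ (c ≡ᵇ c'))

data Fact : Set where
  Created      : Refob → Fact
  Released     : Refob → Fact
  CreatedUsing : Refob → Refob → Fact
  Activated    : Refob → Fact
  Unreleased   : Refob → Fact
  SentCount    : Refob → ℕ → Fact
  RecvCount    : Refob → ℕ → Fact

_==F_ : Fact → Fact → Bool
Created x        ==F Created x'         = x ==R x'
Released x       ==F Released x'        = x ==R x'
CreatedUsing x y ==F CreatedUsing x' y' = (x ==R x') ∧ (y ==R y')
Activated x      ==F Activated x'       = x ==R x'
Unreleased x     ==F Unreleased x'      = x ==R x'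
SentCount x n    ==F SentCount x' n'    = (x ==R x') ∧ (n ≡ᵇ n')
RecvCount x n    ==F RecvCount x' n'    = (x ==R x') ∧ (n ≡ᵇ n')
_                ==F _                  = false

-- Knowledge sets are finite sets of facts, represented as lists;
-- membership is list membership, removal removes every copy.
KSet : Set
KSet = List Fact

removeF : Fact → KSet → KSet
removeF f Φ = filterᵇ (λ g → not (g ==F f)) Φ

isRecvOf : Refob → Fact → Bool
isRecvOf x (RecvCount r n) = r ==R x
isRecvOf x _               = false

removeRecvs : Refob → KSet → KSet
removeRecvs x Φ = filterᵇ (λ g → not (isRecvOf x g)) Φ

data _⊢_ (Φ : KSet) : Fact → Set where
  ax         : ∀ {φ} → φ ∈ Φ → Φ ⊢ φ
  sent0      : ∀ {x} → (∀ n → SentCount x n ∉ Φ) → Φ ⊢ SentCount x 0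
  recv0      : ∀ {x} → (∀ n → RecvCount x n ∉ Φ) → Φ ⊢ RecvCount x 0
  unreleased : ∀ {x} → Φ ⊢ Created x → Released x ∉ Φ → Φ ⊢ Unreleased x
  createdU   : ∀ {x y} → Φ ⊢ CreatedUsing x y → Φ ⊢ Created y

data Msg : Set where
  app     : Refob → List Refob → Msg
  info    : Refob → Refob → Actor → Msg   -- info(y, z, B), delivered along y
  release : Refob → ℕ → Msg

record ActorState : Set where
  constructor st
  field
    busy  : Bool
    facts : KSet
open ActorState public

record Config : Set where
  constructor cfg
  field
    α : Actor → Maybe ActorState
    μ : List Msg
    ρ : List Actor
    χ : List Actor
open Config public

upd : (Actor → Maybe ActorState) → Actor → ActorState → (Actor → Maybe ActorState)
upd f a s b = if b ≡ᵇ a then just s else f b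

emptyα : Actor → Maybe ActorState
emptyα _ = nothing

initConfig : (A E x y : ℕ) → Config
initConfig A E x y =
  cfg (upd emptyα A (st true (Activated (ref x A E) ∷ Created (ref y A A) ∷ Activated (ref y A A) ∷ [])))
      [] [] (E ∷ [])

refsF : Fact → List Refob
refsF (Created x)        = x ∷ []
refsF (Released x)       = x ∷ []
refsF (CreatedUsing x y) = x ∷ y ∷ []
refsF (Activated x)      = x ∷ []
refsF (Unreleased x)     = x ∷ []
refsF (SentCount x _)    = x ∷ []
refsF (RecvCount x _)    = x ∷ []

refsM : Msg → List Refob
refsM (app x R)       = x ∷ R
refsM (info y z _)    = y ∷ z ∷ []
refsM (release x _)   = x ∷ []

actsOf : List Refob → List Actor
actsOf []       = []
actsOf (r ∷ rs) = owner r ∷ target r ∷ actsOf rs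

actsM : Msg → List Actor
actsM (info y z B) = B ∷ actsOf (y ∷ z ∷ [])
actsM m            = actsOf (refsM m)

TokUsed : Config → Token → Set
TokUsed c t =
  (∃₂ λ a s → α c a ≡ just s × Any (λ f → t ∈ map token (refsF f)) (facts s))
  ⊎ Any (λ m → t ∈ map token (refsM m)) (μ c)

ActUsed : Config → Actor → Set
ActUsed c a =
  (∃ λ s → α c a ≡ just s) ⊎ (a ∈ ρ c) ⊎ (a ∈ χ c)
  ⊎ (∃₂ λ b s → α c b ≡ just s × Any (λ f → a ∈ actsOf (refsF f)) (facts s))
  ⊎ Any (λ m → a ∈ actsM m) (μ c)

data Label : Set where
  spawnL      : Actor → Actor → Label
  sendL       : Actor → Msg → Label     -- internal actor sends a message (Send, SendInfo, SendRelease)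
  recvL       : Actor → Msg → Label     -- internal actor receives a message (Receive, Info, Release)
  idleL       : Actor → Label
  compactionL : Actor → Label
  snapshotL   : Actor → Label
  inL         : Msg → Label
  outL        : Msg → Label             -- Out, ReleaseOut, InfoOut

-- the new refob z_i : B → C_i created from y_i : A → C_i and fresh token t_i
mkZ : Refob → Refob × Token → Refob
mkZ x p = ref (proj₂ p) (target x) (target (proj₁ p))

mkCU : Refob → Refob × Token → Fact
mkCU x p = CreatedUsing (proj₁ p) (mkZ x p)

internals : (Actor → Maybe ActorState) → List Actor → List Actor
internals a bs = filterᵇ (λ b → is-just (a b)) bs

-- One transition.  UT / UA : the tokens / actor names already used
-- (anywhere in the execution so far); "fresh" means not used.
data Step (UT UA : ℕ → Set) : Config → Label → Config → Set where
  spawn : ∀ {α μ ρ χ A Φ B x y} →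
    α A ≡ just (st true Φ) → ¬ UA B → ¬ UT x → ¬ UT y → x ≢ y →
    Step UT UA (cfg α μ ρ χ) (spawnL A B)
      (cfg (upd (upd α A (st true (Activated (ref x A B) ∷ Φ))) B
                (st true (Created (ref x A B) ∷ Created (ref y B B) ∷ Activated (ref y B B) ∷ [])))
           μ ρ χ)
  send : ∀ {α μ ρ χ A Φ x n} (ps : List (Refob × Token)) →
    α A ≡ just (st true Φ) → owner x ≡ A → Φ ⊢ Activated x →
    All (λ p → owner (proj₁ p) ≡ A × Φ ⊢ Activated (proj₁ p) × ¬ UT (proj₂ p)) ps →
    Unique (map proj₂ ps) →
    Φ ⊢ SentCount x n →
    Step UT UA (cfg α μ ρ χ) (sendL A (app x (map (mkZ x) ps)))
      (cfg (upd α A (st true (map (mkCU x) ps ++ (SentCount x (suc n) ∷ removeF (SentCount x n) Φ))))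
           (app x (map (mkZ x) ps) ∷ μ) ρ χ)
  receive : ∀ {α μ₁ μ₂ ρ χ B Φ x R n} →
    α B ≡ just (st false Φ) → target x ≡ B → Φ ⊢ RecvCount x n →
    Step UT UA (cfg α (μ₁ ++ (app x R ∷ μ₂)) ρ χ) (recvL B (app x R))
      (cfg (upd α B (st true (map Activated R ++ (RecvCount x (suc n) ∷ removeF (RecvCount x n) Φ))))
           (μ₁ ++ μ₂) ρ χ)
  idle : ∀ {α μ ρ χ A Φ} →
    α A ≡ just (st true Φ) →
    Step UT UA (cfg α μ ρ χ) (idleL A) (cfg (upd α A (st false Φ)) μ ρ χ)
  sendInfo : ∀ {α μ ρ χ A Φ y z n} →
    α A ≡ just (st true Φ) → owner y ≡ A → CreatedUsing y z ∈ Φ → Φ ⊢ SentCount y n →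
    Step UT UA (cfg α μ ρ χ) (sendL A (info y z (owner z)))
      (cfg (upd α A (st true (SentCount y (suc n) ∷ removeF (SentCount y n) (removeF (CreatedUsing y z) Φ))))
           (info y z (owner z) ∷ μ) ρ χ)
  infoR : ∀ {α μ₁ μ₂ ρ χ C Φ y z B n} →
    α C ≡ just (st false Φ) → target y ≡ C → Φ ⊢ RecvCount y n →
    Step UT UA (cfg α (μ₁ ++ (info y z B ∷ μ₂)) ρ χ) (recvL C (info y z B))
      (cfg (upd α C (st false (Created z ∷ RecvCount y (suc n) ∷ removeF (RecvCount y n) Φ)))
           (μ₁ ++ μ₂) ρ χ)
  sendRelease : ∀ {α μ ρ χ A Φ x n} →
    α A ≡ just (st true Φ) → owner x ≡ A → Φ ⊢ Activated x → Φ ⊢ SentCount x n →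
    (∀ z → ¬ (Φ ⊢ CreatedUsing x z)) →
    Step UT UA (cfg α μ ρ χ) (sendL A (release x n))
      (cfg (upd α A (st true (removeF (SentCount x n) (removeF (Activated x) Φ))))
           (release x n ∷ μ) ρ χ)
  releaseR : ∀ {α μ₁ μ₂ ρ χ B Φ x n} →
    α B ≡ just (st false Φ) → target x ≡ B → Φ ⊢ RecvCount x n →
    Step UT UA (cfg α (μ₁ ++ (release x n ∷ μ₂)) ρ χ) (recvL B (release x n))
      (cfg (upd α B (st false (Released x ∷ Φ))) (μ₁ ++ μ₂) ρ χ)
  compaction : ∀ {α μ ρ χ C Φ x} →
    α C ≡ just (st false Φ) → target x ≡ C → Created x ∈ Φ → Released x ∈ Φ →
    Step UT UA (cfg α μ ρ χ) (compactionL C)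
      (cfg (upd α C (st false (removeRecvs x (removeF (Released x) (removeF (Created x) Φ))))) μ ρ χ)
  snapshot : ∀ {α μ ρ χ A Φ} →
    α A ≡ just (st false Φ) →
    Step UT UA (cfg α μ ρ χ) (snapshotL A) (cfg α μ ρ χ)
  inR : ∀ {α μ ρ χ A x R} (χ' : List Actor) →
    A ∈ ρ → target x ≡ A → owner x ∈ (χ ++ χ') →
    All (λ r → owner r ≡ A × target r ∈ (χ ++ χ')) R →
    All (λ b → α b ≡ nothing) χ' →
    All (λ t → ¬ UT t) (map token (x ∷ R)) → Unique (map token (x ∷ R)) →
    Step UT UA (cfg α μ ρ χ) (inL (app x R)) (cfg α (app x R ∷ μ) ρ (χ ++ χ'))
  out : ∀ {α μ₁ μ₂ ρ χ x R} →
    target x ∈ χ →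
    Step UT UA (cfg α (μ₁ ++ (app x R ∷ μ₂)) ρ χ) (outL (app x R))
      (cfg α (μ₁ ++ μ₂) (ρ ++ internals α (map target R)) χ)
  releaseOut : ∀ {α μ₁ μ₂ ρ χ x n} →
    target x ∈ χ →
    Step UT UA (cfg α (μ₁ ++ (release x n ∷ μ₂)) ρ χ) (outL (release x n)) (cfg α (μ₁ ++ μ₂) ρ χ)
  infoOut : ∀ {α μ₁ μ₂ ρ χ y z B} →
    target y ∈ χ →
    Step UT UA (cfg α (μ₁ ++ (info y z B ∷ μ₂)) ρ χ) (outL (info y z B)) (cfg α (μ₁ ++ μ₂) ρ χ)

UsedTokUpTo : (ℕ → Config) → ℕ → Token → Set
UsedTokUpTo conf i t = ∃ λ k → k ≤ i × TokUsed (conf k) t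

UsedActUpTo : (ℕ → Config) → ℕ → Actor → Set
UsedActUpTo conf i a = ∃ λ k → k ≤ i × ActUsed (conf k) a

record Execution (c₀ : Config) : Set where
  field
    len   : ℕ
    conf  : ℕ → Config
    lab   : ℕ → Label
    start : conf 0 ≡ c₀
    steps : ∀ i → i < len →
            Step (UsedTokUpTo conf i) (UsedActUpTo conf i) (conf i) (lab i) (conf (suc i))

HasFact : Config → Actor → Fact → Set
HasFact c A f = ∃ λ s → α c A ≡ just s × f ∈ facts s

{-# OPTIONS --safe #-}
-- Of the facts a knowledge set may hold, CreatedUsing(y, z), Created z and Released z can each
-- leave it in only one way: the first by SendInfo, which sends the info message containing z, the
-- other two by Compaction, which requires both of them to be present. So if Created z is lost,
-- Released z was present at some earlier step, and Released z enters a knowledge set only on receipt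
-- of a release message along z. If Released z is lost, Created z was present earlier; it entered
-- either on receipt of an info message containing z, or by a Spawn choosing the token of z fresh.
-- The latter is impossible: the Send that added CreatedUsing(y, z) also chose that token fresh,
-- and two different steps cannot both do so.
module Submission where

open import Defs
open import Data.Nat using (ℕ; zero; suc; _≤_; _<_; _≤′_; ≤′-refl; ≤′-step; _≡ᵇ_; z≤n)
open import Data.Nat.Properties
  using (_≟_; ≡ᵇ⇒≡; ≡⇒≡ᵇ; ≤-refl; ≤-trans; ≤⇒≤′; ≤-antisym; <⇒≤; <-trans; ≮⇒≥; n<1+n; m<n⇒m<1+n)
open import Data.Bool using (Bool; true; false; T)
open import Data.Bool.Properties using (T-∧; T-not-≡)
open import Data.Empty using (⊥-elim)
open import Data.Maybe using (Maybe; just)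
open import Data.List using (_∷_; []; map)
open import Data.List.Membership.Propositional using (_∈_; _∉_; lose)
open import Data.List.Membership.Propositional.Properties using (∈-++⁺ʳ; ∈-++⁻; ∈-map⁻; ∈-filter⁺)
open import Data.List.Relation.Binary.Subset.Propositional using (_⊆_)
open import Data.List.Relation.Binary.Subset.Propositional.Properties using (filter-⊆)
open import Data.List.Relation.Unary.All as All using (All)
open import Data.List.Relation.Unary.Any using (here; there)
open import Data.Product using (∃; ∃₂; _×_; _,_; proj₂)
open import Data.Sum using (_⊎_; inj₁; inj₂; [_,_]′; map₁)
open import Function using (_∘_; id; case_of_; Equivalence)
open import Relation.Nullary using (¬_; yes; no)
open import Relation.Binary.PropositionalEquality using (_≡_; _≢_; refl; sym; trans; cong; cong₂; subst)

data Tracked : Fact → Set where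
  created      : ∀ {x} → Tracked (Created x)
  released     : ∀ {x} → Tracked (Released x)
  createdUsing : ∀ {y z} → Tracked (CreatedUsing y z)

data Bookkeeping : Fact → Set where
  activated : ∀ {x} → Bookkeeping (Activated x)
  sentCount : ∀ {x n} → Bookkeeping (SentCount x n)
  recvCount : ∀ {x n} → Bookkeeping (RecvCount x n)

tracked⇒¬bookkeeping : ∀ {f} → Tracked f → ¬ Bookkeeping f
tracked⇒¬bookkeeping created ()
tracked⇒¬bookkeeping released ()
tracked⇒¬bookkeeping createdUsing ()

==R⇒≡ : ∀ r r′ → T (r ==R r′) → r ≡ r′
==R⇒≡ (ref a b c) (ref a′ b′ c′) same
  with a≡a′ , b≡b′∧c≡c′ ← Equivalence.to T-∧ same
  with b≡b′ , c≡c′ ← Equivalence.to T-∧ b≡b′∧c≡c′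
  with refl ← ≡ᵇ⇒≡ a a′ a≡a′ | refl ← ≡ᵇ⇒≡ b b′ b≡b′ | refl ← ≡ᵇ⇒≡ c c′ c≡c′ = refl

==F⇒≡ : ∀ {f g} → Tracked f → Tracked g → T (f ==F g) → f ≡ g
==F⇒≡ (created {x}) (created {x′}) same = cong Created (==R⇒≡ x x′ same)
==F⇒≡ (released {x}) (released {x′}) same = cong Released (==R⇒≡ x x′ same)
==F⇒≡ (createdUsing {y} {z}) (createdUsing {y′} {z′}) same
  with y≡y′ , z≡z′ ← Equivalence.to T-∧ same =
  cong₂ CreatedUsing (==R⇒≡ y y′ y≡y′) (==R⇒≡ z z′ z≡z′)
==F⇒≡ created      released     ()
==F⇒≡ created      createdUsing ()
==F⇒≡ released     created      ()
==F⇒≡ released     createdUsing ()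
==F⇒≡ createdUsing created      ()
==F⇒≡ createdUsing released     ()

tracked-≢ᵇ-bookkeeping : ∀ {f g} → Tracked f → Bookkeeping g → ¬ T (f ==F g)
tracked-≢ᵇ-bookkeeping created      activated ()
tracked-≢ᵇ-bookkeeping created      sentCount ()
tracked-≢ᵇ-bookkeeping created      recvCount ()
tracked-≢ᵇ-bookkeeping released     activated ()
tracked-≢ᵇ-bookkeeping released     sentCount ()
tracked-≢ᵇ-bookkeeping released     recvCount ()
tracked-≢ᵇ-bookkeeping createdUsing activated ()
tracked-≢ᵇ-bookkeeping createdUsing sentCount ()
tracked-≢ᵇ-bookkeeping createdUsing recvCount ()

∈-removeF : ∀ {f} g {Φ} → f ∈ Φ → T (f ==F g) ⊎ f ∈ removeF g Φ
∈-removeF {f} g f∈Φ with f ==F g in same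
... | true  = inj₁ _
... | false = inj₂ (∈-filter⁺ _ f∈Φ (Equivalence.from T-not-≡ same))

∈-removeF-tracked : ∀ {f g Φ} → Tracked f → Tracked g → f ∈ Φ → f ≡ g ⊎ f ∈ removeF g Φ
∈-removeF-tracked {g = g} tf tg f∈Φ = map₁ (==F⇒≡ tf tg) (∈-removeF g f∈Φ)

∈-removeF-bookkeeping : ∀ {f g Φ} → Tracked f → Bookkeeping g → f ∈ Φ → f ∈ removeF g Φ
∈-removeF-bookkeeping {g = g} tf bg f∈Φ =
  [ ⊥-elim ∘ tracked-≢ᵇ-bookkeeping tf bg , id ]′ (∈-removeF g f∈Φ)

removeF-⊆ : ∀ g Φ → removeF g Φ ⊆ Φ
removeF-⊆ g = filter-⊆ _

∈-removeRecvs⁺ : ∀ {f x Φ} → Tracked f → f ∈ Φ → f ∈ removeRecvs x Φ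
∈-removeRecvs⁺ created      f∈Φ = ∈-filter⁺ _ f∈Φ _
∈-removeRecvs⁺ released     f∈Φ = ∈-filter⁺ _ f∈Φ _
∈-removeRecvs⁺ createdUsing f∈Φ = ∈-filter⁺ _ f∈Φ _

removeRecvs-⊆ : ∀ x Φ → removeRecvs x Φ ⊆ Φ
removeRecvs-⊆ x = filter-⊆ _

∈-∷-bookkeeping⁻ : ∀ {f g Φ} → Tracked f → Bookkeeping g → f ∈ g ∷ Φ → f ∈ Φ
∈-∷-bookkeeping⁻ tf bg (here refl) = ⊥-elim (tracked⇒¬bookkeeping tf bg)
∈-∷-bookkeeping⁻ tf bg (there f∈Φ) = f∈Φ

-- HasFact as a record, so that the actor map and the actor can be inferred from a proof's type.
record Knows (actors : Actor → Maybe ActorState) (D : Actor) (f : Fact) : Set where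
  constructor knows
  field
    {state} : ActorState
    lookup  : actors D ≡ just state
    member  : f ∈ facts state

HasFact⇒Knows : ∀ {actors D f} → (∃ λ s → actors D ≡ just s × f ∈ facts s) → Knows actors D f
HasFact⇒Knows (_ , D↦s , f∈s) = knows D↦s f∈s

Knows⇒HasFact : ∀ {actors D f} → Knows actors D f → ∃ λ s → actors D ≡ just s × f ∈ facts s
Knows⇒HasFact (knows D↦s f∈s) = _ , D↦s , f∈s

upd-≡ : ∀ actors A s → upd actors A s A ≡ just s
upd-≡ actors A s with A ≡ᵇ A | ≡⇒≡ᵇ A A refl
... | true | _ = refl

upd-≢ : ∀ actors {A D} s → D ≢ A → upd actors A s D ≡ actors D
upd-≢ actors {A} {D} s D≢A with D ≡ᵇ A | ≡ᵇ⇒≡ D A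
... | false | _    = refl
... | true  | D≡A = ⊥-elim (D≢A (D≡A _))

knows-upd-≢⁺ : ∀ {actors A s D f} → D ≢ A → Knows actors D f → Knows (upd actors A s) D f
knows-upd-≢⁺ {actors} {s = s} D≢A (knows D↦s′ f∈s′) = knows (trans (upd-≢ actors s D≢A) D↦s′) f∈s′

knows-upd-≢⁻ : ∀ {actors A s D f} → D ≢ A → Knows (upd actors A s) D f → Knows actors D f
knows-upd-≢⁻ {actors} {s = s} D≢A (knows D↦s′ f∈s′) = knows (trans (sym (upd-≢ actors s D≢A)) D↦s′) f∈s′

knows-upd-≡ : ∀ {actors A s f} → Knows (upd actors A s) A f → f ∈ facts s
knows-upd-≡ {actors} {A} {s} (knows A↦s′ f∈s′) with trans (sym (upd-≡ actors A s)) A↦s′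
... | refl = f∈s′

data RemovedBy (l : Label) (actors : Actor → Maybe ActorState) (D : Actor) : Fact → Set where
  sentInfo          : ∀ {y z} → l ≡ sendL D (info y z (owner z)) → RemovedBy l actors D (CreatedUsing y z)
  compactedCreated  : ∀ {x} → l ≡ compactionL D → Knows actors D (Released x) → RemovedBy l actors D (Created x)
  compactedReleased : ∀ {x} → l ≡ compactionL D → Knows actors D (Created x) → RemovedBy l actors D (Released x)

data AddedBy (Used : Token → Set) (l : Label) (D : Actor) : Fact → Set where
  receivedInfo    : ∀ {y x B} → l ≡ recvL D (info y x B) → AddedBy Used l D (Created x)
  spawned         : ∀ {A x} → l ≡ spawnL A D → ¬ Used (token x) → AddedBy Used l D (Created x)
  receivedRelease : ∀ {x n} → l ≡ recvL D (release x n) → AddedBy Used l D (Released x)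
  sent            : ∀ {y z m} → l ≡ sendL D m → ¬ Used (token z) → AddedBy Used l D (CreatedUsing y z)

module _ {actors : Actor → Maybe ActorState} {A D : Actor} {b b′ : Bool} {Φ Φ′ : KSet} {f : Fact}
         (A↦Φ : actors A ≡ just (st b Φ)) where

  knows-upd⁺ : ∀ {l} → (f ∈ Φ → f ∈ Φ′ ⊎ RemovedBy l actors A f) →
    Knows actors D f → Knows (upd actors A (st b′ Φ′)) D f ⊎ RemovedBy l actors D f
  knows-upd⁺ keep known@(knows D↦s f∈s) with D ≟ A
  ... | no D≢A = inj₁ (knows-upd-≢⁺ D≢A known)
  ... | yes refl with trans (sym A↦Φ) D↦s
  ... | refl = map₁ (knows (upd-≡ actors A _)) (keep f∈s)

  knows-upd⁻ : ∀ {Used l} → (f ∈ Φ′ → f ∈ Φ ⊎ AddedBy Used l A f) →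
    Knows (upd actors A (st b′ Φ′)) D f → Knows actors D f ⊎ AddedBy Used l D f
  knows-upd⁻ gained known with D ≟ A
  ... | no D≢A = inj₁ (knows-upd-≢⁻ D≢A known)
  ... | yes refl = map₁ (knows A↦Φ) (gained (knows-upd-≡ known))

step-preserves : ∀ {UT UA c l c′ D f} → Tracked f → Step UT UA c l c′ →
  (∀ {a s} → α c a ≡ just s → UA a) →
  Knows (α c) D f → Knows (α c′) D f ⊎ RemovedBy l (α c) D f
step-preserves {D = D} t (spawn {B = B} A↦Φ B-fresh _ _ _) live known@(knows D↦s _) =
  map₁ (knows-upd-≢⁺ D≢B) (knows-upd⁺ A↦Φ (inj₁ ∘ there) known)
  where
  D≢B : D ≢ B
  D≢B refl = B-fresh (live D↦s)
step-preserves t (send _ A↦Φ _ _ _ _ _) _ =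
  knows-upd⁺ A↦Φ (inj₁ ∘ ∈-++⁺ʳ _ ∘ there ∘ ∈-removeF-bookkeeping t sentCount)
step-preserves t (receive A↦Φ _ _) _ =
  knows-upd⁺ A↦Φ (inj₁ ∘ ∈-++⁺ʳ _ ∘ there ∘ ∈-removeF-bookkeeping t recvCount)
step-preserves t (idle A↦Φ) _ = knows-upd⁺ A↦Φ inj₁
step-preserves t (sendInfo {y = y} {z = z} A↦Φ _ _ _) _ =
  knows-upd⁺ A↦Φ
    ([ (λ { refl → inj₂ (sentInfo refl) }) , inj₁ ∘ there ∘ ∈-removeF-bookkeeping t sentCount ]′
     ∘ ∈-removeF-tracked t (createdUsing {y} {z}))
step-preserves t (infoR A↦Φ _ _) _ =
  knows-upd⁺ A↦Φ (inj₁ ∘ there ∘ there ∘ ∈-removeF-bookkeeping t recvCount)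
step-preserves t (sendRelease A↦Φ _ _ _ _) _ =
  knows-upd⁺ A↦Φ (inj₁ ∘ ∈-removeF-bookkeeping t sentCount ∘ ∈-removeF-bookkeeping t activated)
step-preserves t (releaseR A↦Φ _ _) _ = knows-upd⁺ A↦Φ (inj₁ ∘ there)
step-preserves t (compaction {x = x} A↦Φ _ Created∈Φ Released∈Φ) _ =
  knows-upd⁺ A↦Φ λ f∈Φ → case ∈-removeF-tracked t (created {x}) f∈Φ of λ where
    (inj₁ refl) → inj₂ (compactedCreated refl (knows A↦Φ Released∈Φ))
    (inj₂ f∈Φ′) → case ∈-removeF-tracked t (released {x}) f∈Φ′ of λ where
      (inj₁ refl) → inj₂ (compactedReleased refl (knows A↦Φ Created∈Φ))
      (inj₂ f∈Φ″) → inj₁ (∈-removeRecvs⁺ t f∈Φ″)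
step-preserves t (snapshot _)                _ = inj₁
step-preserves t (inR _ _ _ _ _ _ _ _)       _ = inj₁
step-preserves t (out _)                     _ = inj₁
step-preserves t (releaseOut _)              _ = inj₁
step-preserves t (infoOut _)                 _ = inj₁

spawn-adds : ∀ {Used A B x y f} → Tracked f → ¬ Used x → ¬ Used y →
  f ∈ Created (ref x A B) ∷ Created (ref y B B) ∷ Activated (ref y B B) ∷ [] →
  AddedBy Used (spawnL A B) B f
spawn-adds _ x-fresh _       (here refl)                 = spawned refl x-fresh
spawn-adds _ _       y-fresh (there (here refl))         = spawned refl y-fresh
spawn-adds t _       _       (there (there (here refl))) = ⊥-elim (tracked⇒¬bookkeeping t activated)

send-adds : ∀ {Used A m x f ps} → All (λ p → ¬ Used (proj₂ p)) ps → f ∈ map (mkCU x) ps →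
  AddedBy Used (sendL A m) A f
send-adds {x = x} fresh f∈ with ∈-map⁻ (mkCU x) f∈
... | _ , p∈ps , refl = sent refl (All.lookup fresh p∈ps)

tracked-∉-map-Activated : ∀ {f R} → Tracked f → f ∉ map Activated R
tracked-∉-map-Activated t f∈ with ∈-map⁻ Activated f∈
... | _ , _ , refl = tracked⇒¬bookkeeping t activated

step-reflects : ∀ {UT UA c l c′ D f} → Tracked f → Step UT UA c l c′ →
  Knows (α c′) D f → Knows (α c) D f ⊎ AddedBy UT l D f
step-reflects {D = D} t (spawn {B = B} A↦Φ _ x-fresh y-fresh _) known with D ≟ B
... | yes refl = inj₂ (spawn-adds t x-fresh y-fresh (knows-upd-≡ known))
... | no D≢B   = knows-upd⁻ A↦Φ (inj₁ ∘ ∈-∷-bookkeeping⁻ t activated) (knows-upd-≢⁻ D≢B known)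
step-reflects t (send {x = x} ps A↦Φ _ _ fresh _ _) =
  knows-upd⁻ A↦Φ
    ([ inj₂ ∘ send-adds {x = x} (All.map (proj₂ ∘ proj₂) fresh)
     , inj₁ ∘ removeF-⊆ _ _ ∘ ∈-∷-bookkeeping⁻ t sentCount
     ]′ ∘ ∈-++⁻ (map (mkCU x) ps))
step-reflects t (receive {R = R} A↦Φ _ _) =
  knows-upd⁻ A↦Φ
    ([ ⊥-elim ∘ tracked-∉-map-Activated t
     , inj₁ ∘ removeF-⊆ _ _ ∘ ∈-∷-bookkeeping⁻ t recvCount
     ]′ ∘ ∈-++⁻ (map Activated R))
step-reflects t (idle A↦Φ) = knows-upd⁻ A↦Φ inj₁
step-reflects t (sendInfo A↦Φ _ _ _) =
  knows-upd⁻ A↦Φ (inj₁ ∘ removeF-⊆ _ _ ∘ removeF-⊆ _ _ ∘ ∈-∷-bookkeeping⁻ t sentCount)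
step-reflects t (infoR A↦Φ _ _) =
  knows-upd⁻ A↦Φ λ where
    (here refl) → inj₂ (receivedInfo refl)
    (there f∈)  → inj₁ (removeF-⊆ _ _ (∈-∷-bookkeeping⁻ t recvCount f∈))
step-reflects t (sendRelease A↦Φ _ _ _ _) = knows-upd⁻ A↦Φ (inj₁ ∘ removeF-⊆ _ _ ∘ removeF-⊆ _ _)
step-reflects t (releaseR A↦Φ _ _) =
  knows-upd⁻ A↦Φ λ where
    (here refl) → inj₂ (receivedRelease refl)
    (there f∈Φ) → inj₁ f∈Φ
step-reflects t (compaction A↦Φ _ _ _) =
  knows-upd⁻ A↦Φ (inj₁ ∘ removeF-⊆ _ _ ∘ removeF-⊆ _ _ ∘ removeRecvs-⊆ _ _)
step-reflects t (snapshot _)          = inj₁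
step-reflects t (inR _ _ _ _ _ _ _ _) = inj₁
step-reflects t (out _)               = inj₁
step-reflects t (releaseOut _)        = inj₁
step-reflects t (infoOut _)           = inj₁

knows-initConfig : ∀ A E x y {D f} → Knows (α (initConfig A E x y)) D f →
  f ∈ Activated (ref x A E) ∷ Created (ref y A A) ∷ Activated (ref y A A) ∷ []
knows-initConfig A E x y {D} known with D ≟ A
... | yes refl = knows-upd-≡ known
... | no D≢A with knows-upd-≢⁻ D≢A known
... | knows () _

initConfig-tracked⇒Created : ∀ A E x y {D f} → Tracked f → Knows (α (initConfig A E x y)) D f →
  ∃ λ r → f ≡ Created r
initConfig-tracked⇒Created A E x y t known with knows-initConfig A E x y known
... | here refl                 = ⊥-elim (tracked⇒¬bookkeeping t activated)
... | there (here refl)         = _ , refl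
... | there (there (here refl)) = ⊥-elim (tracked⇒¬bookkeeping t activated)

initConfig-∌Released : ∀ A E x y {D z} → ¬ Knows (α (initConfig A E x y)) D (Released z)
initConfig-∌Released A E x y known with initConfig-tracked⇒Created A E x y released known
... | _ , ()

initConfig-∌CreatedUsing : ∀ A E x y {D w z} → ¬ Knows (α (initConfig A E x y)) D (CreatedUsing w z)
initConfig-∌CreatedUsing A E x y known with initConfig-tracked⇒Created A E x y createdUsing known
... | _ , ()

knows⇒token-used : ∀ c {D f τ} → Knows (α c) D f → τ ∈ map token (refsF f) → TokUsed c τ
knows⇒token-used c {D} (knows D↦s f∈s) τ∈f = inj₁ (D , _ , D↦s , lose f∈s τ∈f)

module _ {c₀ : Config} (e : Execution c₀) where
  open Execution e

  initially : ∀ {D f} → Knows (α (conf 0)) D f → Knows (α c₀) D f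
  initially {D} {f} = subst (λ c → Knows (α c) D f) start

  fresh-before-use : ∀ {s t τ} → ¬ UsedTokUpTo conf s τ → TokUsed (conf (suc t)) τ → s ≤ t
  fresh-before-use fresh used = ≮⇒≥ λ t<s → fresh (_ , t<s , used)

  live⇒used : ∀ k {a s} → α (conf k) a ≡ just s → UsedActUpTo conf k a
  live⇒used k a↦s = k , ≤-refl , inj₁ (_ , a↦s)

  knows-until-removed : ∀ {i j D f} → Tracked f → i ≤′ j → j ≤ len → Knows (α (conf i)) D f →
    Knows (α (conf j)) D f ⊎ ∃ λ k → k < j × RemovedBy (lab k) (α (conf k)) D f
  knows-until-removed t ≤′-refl _ known = inj₁ known
  knows-until-removed t (≤′-step {j} i≤′j) j<len known with knows-until-removed t i≤′j (<⇒≤ j<len) known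
  ... | inj₂ (k , k<j , removed) = inj₂ (k , m<n⇒m<1+n k<j , removed)
  ... | inj₁ known-j with step-preserves t (steps j j<len) (live⇒used j) known-j
  ...   | inj₁ known-j+1 = inj₁ known-j+1
  ...   | inj₂ removed   = inj₂ (j , n<1+n j , removed)

  removed-before : ∀ {i j D f} → Tracked f → i ≤ j → j ≤ len →
    Knows (α (conf i)) D f → ¬ Knows (α (conf j)) D f →
    ∃ λ k → k < j × RemovedBy (lab k) (α (conf k)) D f
  removed-before t i≤j j≤len known unknown =
    [ ⊥-elim ∘ unknown , id ]′ (knows-until-removed t (≤⇒≤′ i≤j) j≤len known)

  knows⇒initially-or-added : ∀ {k D f} → Tracked f → k ≤ len → Knows (α (conf k)) D f →
    Knows (α (conf 0)) D f ⊎
    ∃ λ k′ → k′ < k × AddedBy (UsedTokUpTo conf k′) (lab k′) D f × Knows (α (conf (suc k′))) D f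
  knows⇒initially-or-added {zero}  t _     known = inj₁ known
  knows⇒initially-or-added {suc k} t k<len known with step-reflects t (steps k k<len) known
  ... | inj₂ added = inj₂ (k , n<1+n k , added , known)
  ... | inj₁ known-k with knows⇒initially-or-added t (<⇒≤ k<len) known-k
  ...   | inj₁ known₀                 = inj₁ known₀
  ...   | inj₂ (k′ , k′<k , added-k′) = inj₂ (k′ , m<n⇒m<1+n k′<k , added-k′)

  lost-CreatedUsing⇒info-sent : ∀ {i j A y z} → i ≤ j → j ≤ len →
    HasFact (conf i) A (CreatedUsing y z) → ¬ HasFact (conf j) A (CreatedUsing y z) →
    ∃ λ k → k < j × lab k ≡ sendL A (info y z (owner z))
  lost-CreatedUsing⇒info-sent i≤j j≤len known unknown
    with removed-before createdUsing i≤j j≤len (HasFact⇒Knows known) (unknown ∘ Knows⇒HasFact)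
  ... | k , k<j , sentInfo sent-at-k = k , k<j , sent-at-k

  lost-Created⇒release-received : (∀ {D x} → ¬ Knows (α c₀) D (Released x)) →
    ∀ {i j C z} → i ≤ j → j ≤ len →
    HasFact (conf i) C (Created z) → ¬ HasFact (conf j) C (Created z) →
    ∃ λ k → k < j × ∃ λ n → lab k ≡ recvL C (release z n)
  lost-Created⇒release-received no-Released₀ i≤j j≤len known unknown
    with removed-before created i≤j j≤len (HasFact⇒Knows known) (unknown ∘ Knows⇒HasFact)
  ... | k , k<j , compactedCreated _ released-k
    with knows⇒initially-or-added released (≤-trans (<⇒≤ k<j) j≤len) released-k
  ...   | inj₁ released₀ = ⊥-elim (no-Released₀ (initially released₀))
  ...   | inj₂ (k′ , k′<k , receivedRelease received-at-k′ , _) = k′ , <-trans k′<k k<j , _ , received-at-k′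

  module _ (no-CreatedUsing₀ : ∀ {D y z} → ¬ Knows (α c₀) D (CreatedUsing y z)) where

    created⇒info-received : ∀ {t k A C y z} → t ≤ len → Knows (α (conf t)) A (CreatedUsing y z) →
      k ≤ len → Knows (α (conf k)) C (Created z) →
      ∃ λ k′ → k′ < k × ∃₂ λ y′ B′ → lab k′ ≡ recvL C (info y′ z B′)
    created⇒info-received t≤len minted k≤len known
      with knows⇒initially-or-added createdUsing t≤len minted
    ... | inj₁ minted₀ = ⊥-elim (no-CreatedUsing₀ (initially minted₀))
    ... | inj₂ (t′ , _ , sent sent-at-t′ fresh-at-t′ , minted′)
      with knows⇒initially-or-added created k≤len known
    ...   | inj₁ known₀ = ⊥-elim (fresh-at-t′ (0 , z≤n , knows⇒token-used (conf 0) known₀ (here refl)))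
    ...   | inj₂ (k′ , k′<k , receivedInfo received-at-k′ , _) = k′ , k′<k , _ , _ , received-at-k′
    ...   | inj₂ (s , _ , spawned spawned-at-s fresh-at-s , known′)
      with ≤-antisym (fresh-before-use fresh-at-s (knows⇒token-used (conf (suc t′)) minted′ (there (here refl))))
                     (fresh-before-use fresh-at-t′ (knows⇒token-used (conf (suc s)) known′ (here refl)))
    ...     | refl with trans (sym spawned-at-s) sent-at-t′
    ...       | ()

    lost-Released⇒info-received : ∀ {t A y i j C z} → t ≤ len → HasFact (conf t) A (CreatedUsing y z) →
      i ≤ j → j ≤ len → HasFact (conf i) C (Released z) → ¬ HasFact (conf j) C (Released z) →
      ∃ λ k → k < j × ∃₂ λ y′ B′ → lab k ≡ recvL C (info y′ z B′)
    lost-Released⇒info-received t≤len minted i≤j j≤len known unknown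
      with removed-before released i≤j j≤len (HasFact⇒Knows known) (unknown ∘ Knows⇒HasFact)
    ... | k , k<j , compactedReleased _ created-k
      with created⇒info-received t≤len (HasFact⇒Knows minted) (≤-trans (<⇒≤ k<j) j≤len) created-k
    ...   | k′ , k′<k , received = k′ , <-trans k′<k k<j , received

mainTheorem7 : (A₀ E₀ x₀ y₀ : ℕ) → A₀ ≢ E₀ → x₀ ≢ y₀ →
  (e : Execution (initConfig A₀ E₀ x₀ y₀)) →
  -- (1) CreatedUsing(y : A → C, z : B → C) stays in A's knowledge set until A sends an info message containing z to C
  ((i j : ℕ) (A B C : Actor) (y z : Refob) → i ≤ j → j ≤ Execution.len e →
    owner y ≡ A → target y ≡ C → owner z ≡ B → target z ≡ C →
    HasFact (Execution.conf e i) A (CreatedUsing y z) →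
    ¬ HasFact (Execution.conf e j) A (CreatedUsing y z) →
    ∃ λ k → k < j × ∃₂ λ y' B' → target y' ≡ C × Execution.lab e k ≡ sendL A (info y' z B'))
  ×
  -- (2) Created(z : B → C) stays in C's knowledge set until C receives the release message along z
  ((i j : ℕ) (B C : Actor) (z : Refob) → i ≤ j → j ≤ Execution.len e →
    owner z ≡ B → target z ≡ C →
    -- z : B → C is a refob created as in (1): CreatedUsing(y : A → C, z) is in some A's knowledge set at some point
    (∃ λ t → t ≤ Execution.len e × ∃₂ λ A y → owner y ≡ A × target y ≡ C × HasFact (Execution.conf e t) A (CreatedUsing y z)) →
    HasFact (Execution.conf e i) C (Created z) →
    ¬ HasFact (Execution.conf e j) C (Created z) →
    ∃ λ k → k < j × ∃ λ n → Execution.lab e k ≡ recvL C (release z n))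
  ×
  -- (3) Released(z : B → C) stays in C's knowledge set until C receives the info message containing z
  ((i j : ℕ) (B C : Actor) (z : Refob) → i ≤ j → j ≤ Execution.len e →
    owner z ≡ B → target z ≡ C →
    -- z : B → C is a refob created as in (1): CreatedUsing(y : A → C, z) is in some A's knowledge set at some point
    (∃ λ t → t ≤ Execution.len e × ∃₂ λ A y → owner y ≡ A × target y ≡ C × HasFact (Execution.conf e t) A (CreatedUsing y z)) →
    HasFact (Execution.conf e i) C (Released z) →
    ¬ HasFact (Execution.conf e j) C (Released z) →
    ∃ λ k → k < j × ∃₂ λ y' B' → Execution.lab e k ≡ recvL C (info y' z B'))
mainTheorem7 A₀ E₀ x₀ y₀ _ _ e =
    (λ i j A B C y z i≤j j≤len _ y↦C _ _ known unknown →
       let k , k<j , info-sent = lost-CreatedUsing⇒info-sent e i≤j j≤len known unknown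
       in  k , k<j , y , owner z , y↦C , info-sent)
  , (λ i j B C z i≤j j≤len _ _ _ →
       lost-Created⇒release-received e (initConfig-∌Released A₀ E₀ x₀ y₀) i≤j j≤len)
  , (λ { i j B C z i≤j j≤len _ _ (t , t≤len , A , y , _ , _ , minted) →
       lost-Released⇒info-received e (initConfig-∌CreatedUsing A₀ E₀ x₀ y₀) t≤len minted i≤j j≤len })
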